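{- For all integers $0\le s\le t\le n$ and $0\le m\le\binom{n}{s}$, \[ k^t_s(m)=\binom{n}{t}-\partial^{\,n-s}_{n-t}\Big(\binom{n}{s}-m\Big). \]
   Context: An $s$-graph is a finite vertex set together with a set of $s$-element subsets (edges). For an $s$-graph $\mathcal{A}$ and $q\le s$, the $q$-shadow is $\partial_q(\mathcal{A})=\bigcup_{A\in\mathcal{A}}\binom{A}{q}$ (so $\partial_s(\mathcal{A})=\mathcal{A}$). For $t\ge s$, a $t$-clique of $\mathcal{A}$ is a $t$-set all of whose $s$-subsets are edges, and $k^t(\mathcal{A})$ is the number of $t$-cliques. The colex order on finite subsets of $\mathbb{N}=\{1,2,\dots\}$ is: $A<B$ iff $\max(A\triangle B)\in B$. $\mathbb{C}^{(s)}(m)$ denotes the $s$-graph whose edges are the first $m$ $s$-subsets of $\mathbb{N}$ in colex order. Define $k^t_s(m)=k^t(\mathbb{C}^{(s)}(m))$ and $\partial^{\,s}_q(m)=|\partial_q(\mathbb{C}^{(s)}(m))|$. -}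

module Defs where

open import Data.Bool using (Bool; true; false; _∧_; _∨_; not)
open import Data.Nat using (ℕ; zero; suc; _≡ᵇ_; _<ᵇ_)
open import Data.List using (List; []; _∷_; _++_; map; length; filterᵇ)
open import Data.Bool.ListAction using (all; any)
open import Data.Vec using ([]; _∷_)
open import Data.Fin.Subset using (Subset; ∣_∣; _⊆_; outside; inside)
open import Data.Fin.Subset.Properties using (_⊆?_)
open import Relation.Nullary using (does)

-- Vertex i : Fin n of a subset of [n] represents the positive integer i+1.
-- A subset of [n] is a Vec Bool n; the head is the smallest vertex.

allSubsets : (n : ℕ) → List (Subset n)
allSubsets zero    = [] ∷ []
allSubsets (suc n) = map (outside ∷_) (allSubsets n) ++ map (inside ∷_) (allSubsets n)

-- Colex order: A <colex B  iff  max (A △ B) ∈ B.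
-- Recursing from the head, the largest differing coordinate is found by
-- first comparing the tails (larger vertices), then the head.
colexLt : {n : ℕ} → Subset n → Subset n → Bool
colexLt []       []       = false
colexLt (x ∷ xs) (y ∷ ys) = colexLt xs ys ∨ (sameSet xs ys ∧ (not x ∧ y))
  where
  eqB : Bool → Bool → Bool
  eqB true  true  = true
  eqB false false = true
  eqB _     _     = false
  sameSet : {k : ℕ} → Subset k → Subset k → Bool
  sameSet []       []       = true
  sameSet (a ∷ as) (b ∷ bs) = eqB a b ∧ sameSet as bs

_⊆ᵇ_ : {n : ℕ} → Subset n → Subset n → Bool
A ⊆ᵇ B = does (A ⊆? B)

-- Edge test for C^(s)(m), for a set A ⊆ [n]: A is an s-set and fewer than m
-- s-subsets of ℕ precede A in colex.  (Any s-set B colex-below A satisfies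
-- max B ≤ max A, so B ⊆ [n]; hence counting among subsets of [n] is exact.)
isEdge : (n s m : ℕ) → Subset n → Bool
isEdge n s m A =
  (∣ A ∣ ≡ᵇ s) ∧
  (length (filterᵇ (λ B → (∣ B ∣ ≡ᵇ s) ∧ colexLt B A) (allSubsets n)) <ᵇ m)

cliques : (n s t m : ℕ) → ℕ
cliques n s t m =
  length (filterᵇ
    (λ T → (∣ T ∣ ≡ᵇ t) ∧
           all (λ A → not ((∣ A ∣ ≡ᵇ s) ∧ (A ⊆ᵇ T)) ∨ isEdge n s m A) (allSubsets n))
    (allSubsets n))

shadowSize : (n s q m : ℕ) → ℕ
shadowSize n s q m =
  length (filterᵇ
    (λ Q → (∣ Q ∣ ≡ᵇ q) ∧ any (λ A → isEdge n s m A ∧ (Q ⊆ᵇ A)) (allSubsets n))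
    (allSubsets n))

-- Complementation A ↦ [n] ∖ A reverses the colex order and sends s-sets to (n−s)-sets.
-- Hence, if r and r' are the colex ranks of an s-set A among the s-sets and of its
-- complement among the (n−s)-sets, then r + 1 + r' = C(n,s); so A is a non-edge of
-- C^(s)(m) (r ≥ m) exactly when ∁ A is an edge of C^(n−s)(C(n,s) − m) (r' < C(n,s) − m).
-- A t-set T is a clique iff it contains no non-edge, i.e. iff ∁ T lies in no edge of
-- the complementary family, i.e. iff ∁ T is not in its (n−t)-shadow; now count t-sets.
module Submission where

open import Defs
open import Data.Nat using (ℕ; _≤_; _∸_)
open import Data.Nat.Combinatorics using (_C_)
open import Relation.Binary.PropositionalEquality using (_≡_)

open import Data.Bool using (Bool; true; false; _∧_; _∨_; not)
open import Data.Bool.Properties using (∧-zeroʳ; ∧-identityʳ; T-≡; ⇔→≡)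
open import Data.Bool.ListAction using (all; any; or)
open import Data.Nat using (zero; suc; _+_; _<_; _≡ᵇ_; _<ᵇ_; _≟_; _<?_; _≤?_)
open import Data.Nat.Properties
  using (+-suc; +-comm; +-assoc; +-identityʳ; m+n∸m≡n; ∸-cancelˡ-≡; ≤-trans; ≤-reflexive;
         +-monoʳ-≤; +-cancelˡ-≤; ≡ᵇ⇒≡; m+n≤o⇒m≤o∸n; m≤o∸n⇒m+n≤o; ≤⇒≯; ≰⇒>)
open import Data.Nat.Combinatorics using (nCk+nC[k+1]≡[n+1]C[k+1])
open import Data.List using (List; []; _∷_; _++_; map; length; filterᵇ)
open import Data.List.Properties using (length-++; filter-++; map-++; map-∘; map-cong)
open import Data.List.Relation.Binary.Permutation.Propositional
  using (_↭_; ↭-sym; ↭-reflexive; module PermutationReasoning)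
open import Data.List.Relation.Binary.Permutation.Propositional.Properties
  using (↭-length; filter-↭; map⁺; ++⁺; ++-comm; Any-resp-↭)
open import Data.List.Relation.Unary.Any.Properties using (any⁺; any⁻)
open import Data.Vec using ([]; _∷_)
open import Data.Fin.Subset using (Subset; ∣_∣; ∁; outside; inside)
open import Data.Fin.Subset.Properties
  using (_⊆?_; ∣p∣≤n; ∣∁p∣≡n∸∣p∣; p⊆q⇒∁p⊇∁q; ∁p⊆∁q⇒p⊇q)
open import Data.Product using (_×_; _,_; proj₁; uncurry)
open import Function using (_∘_; mk⇔; Equivalence)
open import Relation.Binary.PropositionalEquality
  using (refl; sym; trans; cong; cong₂; module ≡-Reasoning)
open import Relation.Nullary using (¬_; yes; no)
open import Relation.Nullary.Decidable using (dec-true; dec-false; does-⇔)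

count : {X : Set} → (X → Bool) → List X → ℕ
count p xs = length (filterᵇ p xs)

count-cong : {X : Set} {p q : X → Bool} → (∀ x → p x ≡ q x) → (xs : List X) →
  count p xs ≡ count q xs
count-cong e [] = refl
count-cong {p = p} {q} e (x ∷ xs) with p x | q x | e x
... | true  | .true  | refl = cong suc (count-cong e xs)
... | false | .false | refl = count-cong e xs

count-false : {X : Set} (xs : List X) → count (λ _ → false) xs ≡ 0
count-false []       = refl
count-false (x ∷ xs) = count-false xs

count-++ : {X : Set} (p : X → Bool) (xs ys : List X) →
  count p (xs ++ ys) ≡ count p xs + count p ys
count-++ p xs ys = trans (cong length (filter-++ _ xs ys)) (length-++ (filterᵇ p xs))

count-map : {X Y : Set} (p : Y → Bool) (f : X → Y) (xs : List X) →
  count p (map f xs) ≡ count (p ∘ f) xs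
count-map p f [] = refl
count-map p f (x ∷ xs) with p (f x)
... | true  = cong suc (count-map p f xs)
... | false = count-map p f xs

count-↭ : {X : Set} (p : X → Bool) {xs ys : List X} → xs ↭ ys → count p xs ≡ count p ys
count-↭ p σ = ↭-length (filter-↭ _ σ)

count-∧-not : {X : Set} (p q : X → Bool) (xs : List X) →
  count p xs ≡ count (λ x → p x ∧ q x) xs + count (λ x → p x ∧ not (q x)) xs
count-∧-not p q [] = refl
count-∧-not p q (x ∷ xs) with p x | q x
... | true  | true  = cong suc (count-∧-not p q xs)
... | true  | false = trans (cong suc (count-∧-not p q xs)) (sym (+-suc _ _))
... | false | _     = count-∧-not p q xs

any-cong : {X : Set} {p q : X → Bool} → (∀ x → p x ≡ q x) → (xs : List X) →
  any p xs ≡ any q xs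
any-cong e xs = cong or (map-cong e xs)

any-map : {X Y : Set} (p : Y → Bool) (f : X → Y) (xs : List X) →
  any p (map f xs) ≡ any (p ∘ f) xs
any-map p f xs = cong or (sym (map-∘ xs))

any-↭ : {X : Set} (p : X → Bool) {xs ys : List X} → xs ↭ ys → any p xs ≡ any p ys
any-↭ p σ = ⇔→≡ (mk⇔ (transport σ) (transport (↭-sym σ)))
  where
  transport : ∀ {xs ys} → xs ↭ ys → any p xs ≡ true → any p ys ≡ true
  transport {xs} σ =
    Equivalence.to T-≡ ∘ any⁺ p ∘ Any-resp-↭ σ ∘ any⁻ p xs ∘ Equivalence.from T-≡

all≡not-any-not : {X : Set} (p : X → Bool) (xs : List X) → all p xs ≡ not (any (not ∘ p) xs)
all≡not-any-not p [] = refl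
all≡not-any-not p (x ∷ xs) with p x
... | true  = all≡not-any-not p xs
... | false = refl

data Comparison : Set where
  less equal greater : Comparison

infixl 5 _then_

_then_ : Comparison → Comparison → Comparison
less    then _ = less
equal   then d = d
greater then _ = greater

opposite : Comparison → Comparison
opposite less    = greater
opposite equal   = equal
opposite greater = less

isLess isEqual isGreater : Comparison → Bool
isLess less = true
isLess _    = false
isEqual equal = true
isEqual _     = false
isGreater greater = true
isGreater _       = false

opposite-then : (c d : Comparison) → opposite (c then d) ≡ opposite c then opposite d
opposite-then less    d = refl
opposite-then equal   d = refl
opposite-then greater d = refl

isLess-opposite : (c : Comparison) → isLess (opposite c) ≡ isGreater c
isLess-opposite less    = refl
isLess-opposite equal   = refl
isLess-opposite greater = refl

isEqual-then : (c d : Comparison) → isEqual (c then d) ≡ isEqual c ∧ isEqual d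
isEqual-then less    d = refl
isEqual-then equal   d = refl
isEqual-then greater d = refl

count-by-comparison : {X : Set} (q : X → Bool) (f : X → Comparison) (xs : List X) →
  count q xs ≡ count (λ x → q x ∧ isLess (f x)) xs
             + count (λ x → q x ∧ isEqual (f x)) xs
             + count (λ x → q x ∧ isGreater (f x)) xs
count-by-comparison q f [] = refl
count-by-comparison {X} q f (x ∷ xs) with q x | f x | count-by-comparison q f xs
... | false | _       | ih = ih
... | true  | less    | ih = cong suc ih
... | true  | equal   | ih =
  trans (cong suc ih) (cong (_+ count qGreater xs) (sym (+-suc (count qLess xs) (count qEqual xs))))
  where
  qLess qEqual qGreater : X → Bool
  qLess y    = q y ∧ isLess (f y)
  qEqual y   = q y ∧ isEqual (f y)
  qGreater y = q y ∧ isGreater (f y)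
... | true  | greater | ih = trans (cong suc ih) (sym (+-suc _ _))

-- The colex order as a comparison

compareBool : Bool → Bool → Comparison
compareBool false false = equal
compareBool false true  = less
compareBool true  false = greater
compareBool true  true  = equal

colexCompare : {n : ℕ} → Subset n → Subset n → Comparison
colexCompare []      []      = equal
colexCompare (x ∷ A) (y ∷ B) = colexCompare A B then compareBool x y

-- S stands for the equality test local to colexLt, which cannot be named here;
-- the hypothesis on l ∨ (S ∧ true) is what pins it down.
colexLt-step : ∀ {l S : Bool} (c : Comparison) (x y : Bool) →
  l ≡ isLess c → l ∨ (S ∧ true) ≡ not (isGreater c) →
  l ∨ (S ∧ (not x ∧ y)) ≡ isLess (c then compareBool x y) ×
  (l ∨ (S ∧ (not x ∧ y))) ∨ ((isEqual (compareBool x y) ∧ S) ∧ true)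
    ≡ not (isGreater (c then compareBool x y))
colexLt-step less x y refl _ = refl , refl
colexLt-step {S = true}  equal   false false refl refl = refl , refl
colexLt-step {S = true}  equal   false true  refl refl = refl , refl
colexLt-step {S = true}  equal   true  false refl refl = refl , refl
colexLt-step {S = true}  equal   true  true  refl refl = refl , refl
colexLt-step {S = false} equal   x y refl ()
colexLt-step {S = false} greater x y refl refl =
  refl , cong (_∧ true) (∧-zeroʳ (isEqual (compareBool x y)))
colexLt-step {S = true}  greater x y refl ()

colexLt-colexCompare : {n : ℕ} (A B : Subset n) →
  colexLt A B ≡ isLess (colexCompare A B) ×
  colexLt (outside ∷ A) (inside ∷ B) ≡ not (isGreater (colexCompare A B))
colexLt-colexCompare []          []          = refl , refl
colexLt-colexCompare (false ∷ A) (false ∷ B) = uncurry (colexLt-step _ false false) (colexLt-colexCompare A B)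
colexLt-colexCompare (false ∷ A) (true  ∷ B) = uncurry (colexLt-step _ false true)  (colexLt-colexCompare A B)
colexLt-colexCompare (true  ∷ A) (false ∷ B) = uncurry (colexLt-step _ true  false) (colexLt-colexCompare A B)
colexLt-colexCompare (true  ∷ A) (true  ∷ B) = uncurry (colexLt-step _ true  true)  (colexLt-colexCompare A B)

colexLt≡isLess : {n : ℕ} (A B : Subset n) → colexLt A B ≡ isLess (colexCompare A B)
colexLt≡isLess A B = proj₁ (colexLt-colexCompare A B)

compareBool-not : (x y : Bool) → compareBool (not x) (not y) ≡ opposite (compareBool x y)
compareBool-not false false = refl
compareBool-not false true  = refl
compareBool-not true  false = refl
compareBool-not true  true  = refl

colexCompare-∁ : {n : ℕ} (A B : Subset n) → colexCompare (∁ A) (∁ B) ≡ opposite (colexCompare A B)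
colexCompare-∁ []      []      = refl
colexCompare-∁ (x ∷ A) (y ∷ B) =
  trans (cong₂ _then_ (colexCompare-∁ A B) (compareBool-not x y))
        (sym (opposite-then (colexCompare A B) (compareBool x y)))

colexLt-∁ : {n : ℕ} (A B : Subset n) → colexLt (∁ A) (∁ B) ≡ isGreater (colexCompare A B)
colexLt-∁ A B = begin
  colexLt (∁ A) (∁ B)                  ≡⟨ colexLt≡isLess (∁ A) (∁ B) ⟩
  isLess (colexCompare (∁ A) (∁ B))    ≡⟨ cong isLess (colexCompare-∁ A B) ⟩
  isLess (opposite (colexCompare A B)) ≡⟨ isLess-opposite (colexCompare A B) ⟩
  isGreater (colexCompare A B)         ∎
  where open ≡-Reasoning

compareBool≡equal⇒≡ : (x y : Bool) → compareBool x y ≡ equal → x ≡ y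
compareBool≡equal⇒≡ false false _ = refl
compareBool≡equal⇒≡ true  true  _ = refl
compareBool≡equal⇒≡ false true  ()
compareBool≡equal⇒≡ true  false ()

colexCompare≡equal⇒≡ : {n : ℕ} (A B : Subset n) → colexCompare A B ≡ equal → A ≡ B
colexCompare≡equal⇒≡ []      []      _ = refl
colexCompare≡equal⇒≡ (x ∷ A) (y ∷ B) e with colexCompare A B in eqAB
... | equal = cong₂ _∷_ (compareBool≡equal⇒≡ x y e) (colexCompare≡equal⇒≡ A B eqAB)

count-allSubsets-suc : {n : ℕ} (p : Subset (suc n) → Bool) →
  count p (allSubsets (suc n)) ≡ count (p ∘ (outside ∷_)) (allSubsets n) + count (p ∘ (inside ∷_)) (allSubsets n)
count-allSubsets-suc {n} p = begin
  count p (map (outside ∷_) L ++ map (inside ∷_) L)          ≡⟨ count-++ p (map (outside ∷_) L) _ ⟩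
  count p (map (outside ∷_) L) + count p (map (inside ∷_) L) ≡⟨ cong₂ _+_ (count-map p _ L) (count-map p _ L) ⟩
  count (p ∘ (outside ∷_)) L + count (p ∘ (inside ∷_)) L     ∎
  where
  open ≡-Reasoning
  L : List (Subset n)
  L = allSubsets n

count-allSubsets-size : (n t : ℕ) → count (λ A → ∣ A ∣ ≡ᵇ t) (allSubsets n) ≡ n C t
count-allSubsets-size zero    zero    = refl
count-allSubsets-size zero    (suc t) = refl
count-allSubsets-size (suc n) t = trans (count-allSubsets-suc {n} (λ A → ∣ A ∣ ≡ᵇ t)) (pascal t)
  where
  pascal : ∀ t → count (λ A → ∣ A ∣ ≡ᵇ t) (allSubsets n) + count (λ A → suc ∣ A ∣ ≡ᵇ t) (allSubsets n)
                 ≡ suc n C t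
  pascal zero    = trans (cong₂ _+_ (count-allSubsets-size n 0) (count-false (allSubsets n))) (+-identityʳ 1)
  pascal (suc t) = begin
    count (λ A → ∣ A ∣ ≡ᵇ suc t) (allSubsets n) + count (λ A → ∣ A ∣ ≡ᵇ t) (allSubsets n)
      ≡⟨ cong₂ _+_ (count-allSubsets-size n (suc t)) (count-allSubsets-size n t) ⟩
    n C suc t + n C t ≡⟨ +-comm (n C suc t) (n C t) ⟩
    n C t + n C suc t ≡⟨ nCk+nC[k+1]≡[n+1]C[k+1] n t ⟩
    suc n C suc t     ∎
    where open ≡-Reasoning

count-colexCompare≡equal : {n : ℕ} (A : Subset n) →
  count (λ B → isEqual (colexCompare B A)) (allSubsets n) ≡ 1
count-colexCompare≡equal {zero}  []      = refl
count-colexCompare≡equal {suc n} (a ∷ A) = begin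
  count (λ B → isEqual (colexCompare B (a ∷ A))) (allSubsets (suc n))
    ≡⟨ count-allSubsets-suc (λ B → isEqual (colexCompare B (a ∷ A))) ⟩
  count (λ B → isEqual (colexCompare B A then compareBool false a)) L
    + count (λ B → isEqual (colexCompare B A then compareBool true a)) L
    ≡⟨ cong₂ _+_ (count-cong (λ B → isEqual-then (colexCompare B A) _) L)
                 (count-cong (λ B → isEqual-then (colexCompare B A) _) L) ⟩
  count (λ B → P B ∧ isEqual (compareBool false a)) L + count (λ B → P B ∧ isEqual (compareBool true a)) L
    ≡⟨ exactlyOne a ⟩
  1 ∎
  where
  open ≡-Reasoning
  L : List (Subset n)
  L = allSubsets n
  P : Subset n → Bool
  P B = isEqual (colexCompare B A)
  none : count (λ B → P B ∧ false) L ≡ 0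
  none = trans (count-cong (λ B → ∧-zeroʳ (P B)) L) (count-false L)
  one : count (λ B → P B ∧ true) L ≡ 1
  one = trans (count-cong (λ B → ∧-identityʳ (P B)) L) (count-colexCompare≡equal A)
  exactlyOne : ∀ a → count (λ B → P B ∧ isEqual (compareBool false a)) L
                     + count (λ B → P B ∧ isEqual (compareBool true a)) L ≡ 1
  exactlyOne false = cong₂ _+_ one none
  exactlyOne true  = cong₂ _+_ none one

allSubsets-∁ : (n : ℕ) → map ∁ (allSubsets n) ↭ allSubsets n
allSubsets-∁ zero    = ↭-reflexive refl
allSubsets-∁ (suc n) = begin
  map ∁ (map (outside ∷_) L ++ map (inside ∷_) L)
    ≡⟨ map-++ ∁ (map (outside ∷_) L) _ ⟩
  map ∁ (map (outside ∷_) L) ++ map ∁ (map (inside ∷_) L)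
    ≡⟨ cong₂ _++_ (trans (sym (map-∘ L)) (map-∘ L)) (trans (sym (map-∘ L)) (map-∘ L)) ⟩
  map (inside ∷_) (map ∁ L) ++ map (outside ∷_) (map ∁ L)
    ↭⟨ ++⁺ (map⁺ _ (allSubsets-∁ n)) (map⁺ _ (allSubsets-∁ n)) ⟩
  map (inside ∷_) L ++ map (outside ∷_) L
    ↭⟨ ++-comm (map (inside ∷_) L) _ ⟩
  map (outside ∷_) L ++ map (inside ∷_) L ∎
  where
  open PermutationReasoning
  L : List (Subset n)
  L = allSubsets n

count-∁ : (n : ℕ) (p : Subset n → Bool) → count p (allSubsets n) ≡ count (p ∘ ∁) (allSubsets n)
count-∁ n p = trans (sym (count-↭ p (allSubsets-∁ n))) (count-map p ∁ (allSubsets n))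

any-∁ : (n : ℕ) (p : Subset n → Bool) → any p (allSubsets n) ≡ any (p ∘ ∁) (allSubsets n)
any-∁ n p = trans (sym (any-↭ p (allSubsets-∁ n))) (any-map p ∁ (allSubsets n))

∣∁p∣≡ᵇn∸s : {n : ℕ} (p : Subset n) {s : ℕ} → s ≤ n → (∣ ∁ p ∣ ≡ᵇ n ∸ s) ≡ (∣ p ∣ ≡ᵇ s)
∣∁p∣≡ᵇn∸s {n} p {s} s≤n = does-⇔ (mk⇔ to from) (∣ ∁ p ∣ ≟ n ∸ s) (∣ p ∣ ≟ s)
  where
  to : ∣ ∁ p ∣ ≡ n ∸ s → ∣ p ∣ ≡ s
  to e = ∸-cancelˡ-≡ (∣p∣≤n p) s≤n (trans (sym (∣∁p∣≡n∸∣p∣ p)) e)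
  from : ∣ p ∣ ≡ s → ∣ ∁ p ∣ ≡ n ∸ s
  from e = trans (∣∁p∣≡n∸∣p∣ p) (cong (n ∸_) e)

∁⊆ᵇ∁ : {n : ℕ} (p q : Subset n) → (∁ q ⊆ᵇ ∁ p) ≡ (p ⊆ᵇ q)
∁⊆ᵇ∁ p q = does-⇔ (mk⇔ ∁p⊆∁q⇒p⊇q p⊆q⇒∁p⊇∁q) (∁ q ⊆? ∁ p) (p ⊆? q)

-- Colex ranks and the complementary family

-- isEdge n s m A unfolds to (∣ A ∣ ≡ᵇ s) ∧ (rank n s A <ᵇ m).
rank : (n s : ℕ) → Subset n → ℕ
rank n s A = count (λ B → (∣ B ∣ ≡ᵇ s) ∧ colexLt B A) (allSubsets n)

-- The s-sets split into those below A, A itself and those above A; complementing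
-- the last kind gives exactly the (n−s)-sets below ∁ A.
rank+suc-rank∁ : (n s : ℕ) (A : Subset n) → s ≤ n → ∣ A ∣ ≡ s →
  rank n s A + suc (rank n (n ∸ s) (∁ A)) ≡ n C s
rank+suc-rank∁ n s A s≤n ∣A∣≡s = begin
  rank n s A + suc (rank n (n ∸ s) (∁ A))
    ≡⟨ sym (+-assoc (rank n s A) 1 _) ⟩
  rank n s A + 1 + rank n (n ∸ s) (∁ A)
    ≡⟨ cong₂ _+_ (cong₂ _+_ below (sym atA)) above ⟩
  count (λ B → q B ∧ isLess (cmpA B)) L + count (λ B → q B ∧ isEqual (cmpA B)) L
    + count (λ B → q B ∧ isGreater (cmpA B)) L
    ≡⟨ sym (count-by-comparison q cmpA L) ⟩
  count q L
    ≡⟨ count-allSubsets-size n s ⟩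
  n C s ∎
  where
  open ≡-Reasoning
  L : List (Subset n)
  L = allSubsets n
  q : Subset n → Bool
  q B = ∣ B ∣ ≡ᵇ s
  cmpA : Subset n → Comparison
  cmpA B = colexCompare B A
  below : rank n s A ≡ count (λ B → q B ∧ isLess (cmpA B)) L
  below = count-cong (λ B → cong (q B ∧_) (colexLt≡isLess B A)) L
  onlyA : ∀ B → q B ∧ isEqual (cmpA B) ≡ isEqual (cmpA B)
  onlyA B with cmpA B in e
  ... | less    = ∧-zeroʳ (q B)
  ... | greater = ∧-zeroʳ (q B)
  ... | equal rewrite colexCompare≡equal⇒≡ B A e = trans (∧-identityʳ (q A)) (dec-true (∣ A ∣ ≟ s) ∣A∣≡s)
  atA : count (λ B → q B ∧ isEqual (cmpA B)) L ≡ 1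
  atA = trans (count-cong onlyA L) (count-colexCompare≡equal A)
  above : rank n (n ∸ s) (∁ A) ≡ count (λ B → q B ∧ isGreater (cmpA B)) L
  above = trans (count-∁ n (λ B → (∣ B ∣ ≡ᵇ n ∸ s) ∧ colexLt B (∁ A)))
                (count-cong (λ B → cong₂ _∧_ (∣∁p∣≡ᵇn∸s B s≤n) (colexLt-∁ B A)) L)

<ᵇ∸≡not<ᵇ : (r r' N m : ℕ) → r + suc r' ≡ N → m ≤ N → (r' <ᵇ N ∸ m) ≡ not (r <ᵇ m)
<ᵇ∸≡not<ᵇ r r' N m refl m≤N with m ≤? r
... | yes m≤r =
  trans (dec-true (r' <? N ∸ m) (m+n≤o⇒m≤o∸n (suc r') fits)) (cong not (sym (dec-false (r <? m) (≤⇒≯ m≤r))))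
  where
  fits : suc r' + m ≤ N
  fits = ≤-trans (+-monoʳ-≤ (suc r') m≤r) (≤-reflexive (+-comm (suc r') r))
... | no m≰r =
  trans (dec-false (r' <? N ∸ m) tooBig) (cong not (sym (dec-true (r <? m) (≰⇒> m≰r))))
  where
  tooBig : ¬ (r' < N ∸ m)
  tooBig r'<N∸m = m≰r (+-cancelˡ-≤ (suc r') m r
    (≤-trans (m≤o∸n⇒m+n≤o (suc r') m≤N r'<N∸m) (≤-reflexive (+-comm r (suc r')))))

isEdge-∁ : (n s m : ℕ) → s ≤ n → m ≤ n C s → (A : Subset n) →
  isEdge n (n ∸ s) (n C s ∸ m) (∁ A) ≡ (∣ A ∣ ≡ᵇ s) ∧ not (isEdge n s m A)
isEdge-∁ n s m s≤n m≤nCs A rewrite ∣∁p∣≡ᵇn∸s A s≤n with ∣ A ∣ ≡ᵇ s in e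
... | false = refl
... | true  = <ᵇ∸≡not<ᵇ (rank n s A) (rank n (n ∸ s) (∁ A)) (n C s) m
                (rank+suc-rank∁ n s A s≤n (≡ᵇ⇒≡ ∣ A ∣ s (Equivalence.from T-≡ e))) m≤nCs

-- Cliques and shadows

containsNonEdge : (n s m : ℕ) → Subset n → Bool
containsNonEdge n s m T = any (λ A → ((∣ A ∣ ≡ᵇ s) ∧ not (isEdge n s m A)) ∧ (A ⊆ᵇ T)) (allSubsets n)

not-implication : (a b e : Bool) → not (not (a ∧ b) ∨ e) ≡ (a ∧ not e) ∧ b
not-implication false b     e     = refl
not-implication true  false false = refl
not-implication true  false true  = refl
not-implication true  true  e     = sym (∧-identityʳ (not e))

cliques≡count-¬containsNonEdge : (n s t m : ℕ) →
  cliques n s t m ≡ count (λ T → (∣ T ∣ ≡ᵇ t) ∧ not (containsNonEdge n s m T)) (allSubsets n)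
cliques≡count-¬containsNonEdge n s t m = count-cong noNonEdge (allSubsets n)
  where
  noNonEdge : ∀ T →
    (∣ T ∣ ≡ᵇ t) ∧ all (λ A → not ((∣ A ∣ ≡ᵇ s) ∧ (A ⊆ᵇ T)) ∨ isEdge n s m A) (allSubsets n)
      ≡ (∣ T ∣ ≡ᵇ t) ∧ not (containsNonEdge n s m T)
  noNonEdge T = cong ((∣ T ∣ ≡ᵇ t) ∧_) (trans (all≡not-any-not _ (allSubsets n))
    (cong not (any-cong (λ A → not-implication (∣ A ∣ ≡ᵇ s) (A ⊆ᵇ T) (isEdge n s m A)) (allSubsets n))))

shadowSize≡count-containsNonEdge : (n s t m : ℕ) → s ≤ n → t ≤ n → m ≤ n C s →
  shadowSize n (n ∸ s) (n ∸ t) (n C s ∸ m)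
    ≡ count (λ T → (∣ T ∣ ≡ᵇ t) ∧ containsNonEdge n s m T) (allSubsets n)
shadowSize≡count-containsNonEdge n s t m s≤n t≤n m≤nCs =
  trans (count-∁ n (λ Q → (∣ Q ∣ ≡ᵇ n ∸ t) ∧ any (λ A → edge A ∧ (Q ⊆ᵇ A)) L))
        (count-cong complemented L)
  where
  L : List (Subset n)
  L = allSubsets n
  edge : Subset n → Bool
  edge = isEdge n (n ∸ s) (n C s ∸ m)
  complemented : ∀ T → (∣ ∁ T ∣ ≡ᵇ n ∸ t) ∧ any (λ A → edge A ∧ (∁ T ⊆ᵇ A)) L
                       ≡ (∣ T ∣ ≡ᵇ t) ∧ containsNonEdge n s m T
  complemented T = cong₂ _∧_ (∣∁p∣≡ᵇn∸s T t≤n)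
    (trans (any-∁ n (λ A → edge A ∧ (∁ T ⊆ᵇ A)))
           (any-cong (λ A → cong₂ _∧_ (isEdge-∁ n s m s≤n m≤nCs A) (∁⊆ᵇ∁ A T)) L))

lemma2p3 : (n s t m : ℕ) → s ≤ t → t ≤ n → m ≤ n C s →
    cliques n s t m ≡ n C t ∸ shadowSize n (n ∸ s) (n ∸ t) (n C s ∸ m)
lemma2p3 n s t m s≤t t≤n m≤nCs = begin
  cliques n s t m
    ≡⟨ cliques≡count-¬containsNonEdge n s t m ⟩
  count (sized ∧̇ (not ∘ nonEdge)) L
    ≡⟨ sym (m+n∸m≡n (count (sized ∧̇ nonEdge) L) _) ⟩
  count (sized ∧̇ nonEdge) L + count (sized ∧̇ (not ∘ nonEdge)) L ∸ count (sized ∧̇ nonEdge) L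
    ≡⟨ cong₂ _∸_ (sym (count-∧-not sized nonEdge L)) (sym shadow) ⟩
  count sized L ∸ shadow∂
    ≡⟨ cong (_∸ shadow∂) (count-allSubsets-size n t) ⟩
  n C t ∸ shadow∂ ∎
  where
  open ≡-Reasoning
  L : List (Subset n)
  L = allSubsets n
  sized nonEdge : Subset n → Bool
  sized T = ∣ T ∣ ≡ᵇ t
  nonEdge = containsNonEdge n s m
  _∧̇_ : (Subset n → Bool) → (Subset n → Bool) → Subset n → Bool
  (p ∧̇ q) T = p T ∧ q T
  shadow∂ : ℕ
  shadow∂ = shadowSize n (n ∸ s) (n ∸ t) (n C s ∸ m)
  shadow : shadow∂ ≡ count (sized ∧̇ nonEdge) L
  shadow = shadowSize≡count-containsNonEdge n s t m (≤-trans s≤t t≤n) t≤n m≤nCs
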